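{- Let $G=(V,E)$ be a finite graph, $r\geq1$, and let $G'_r$ be constructed from $G$ and $r$ as in the context. Let $D$ be an effective divisor on $G'_r$ of rank $r$ with $\deg(D)=\operatorname{dgon}_r(G'_r)$. Then for each $v\in V$, \[D(T_v)+D(v')\geq\begin{cases}2r & \text{if } T\sim_D v,\\ 2r+1 & \text{if } T\not\sim_D v.\end{cases}\]
   Context: Graphs are finite connected multigraphs without loops; divisors, effectiveness, equivalence via the Laplacian $L$ ($D'=D-L\sigma$, $\sigma\in\mathbb{Z}^{V}$), rank, and $\operatorname{dgon}_r$ (minimum degree of a rank $r$ divisor) are as in divisor theory on graphs. Construction of $G'_r$: let $M=r(3|V|+2|E|+1)+1$. $G'_r$ has a vertex $T$; for each $v\in V$ three vertices $v,v',T_v$; for each edge $e\in E$ with endpoints $u,v$ two vertices $e_u,e_v$. Edges: $M$ parallel edges between $T$ and each $T_v$; $M$ between each $v$ and $v'$; $r+2$ between each $v'$ and $T_v$; for each edge $e$ of $G$ with endpoints $u,v$, $M$ between $v$ and $e_v$, $M$ between $u$ and $e_u$, and $r$ between $e_u$ and $e_v$. For a divisor $D$, $u\sim_D w$ iff $\sigma(u)=\sigma(w)$ for every $\sigma\in\mathbb{Z}^{V(G'_r)}$ with $D-L\sigma\geq0$. -}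

module Defs where

open import Data.Nat as ℕ using (ℕ; zero; suc)
open import Data.Integer as ℤ using (ℤ; +_; _-_; _≤_)
open import Data.Fin using (Fin)
open import Data.Fin.Properties using () renaming (_≟_ to _≟ᶠ_)
open import Data.Bool using (Bool; true; false)
open import Data.List using (List; []; _∷_; map; _++_; allFin; foldr)
open import Data.Vec using (Vec; lookup)
open import Data.Product using (_×_; _,_; proj₁; proj₂; Σ; ∃)
open import Relation.Nullary using (¬_; yes; no)
open import Relation.Binary.PropositionalEquality using (_≡_)

-- General divisor theory on a finite multigraph (without loops).
-- Vertices: a type V with a list `verts` enumerating each vertex once;
-- mult x y = number of parallel edges between x and y.

record MGraph : Set₁ where
  field
    V     : Set
    verts : List V
    mult  : V → V → ℕ

module DivisorTheory (G : MGraph) where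
  open MGraph G

  Divisor : Set
  Divisor = V → ℤ

  sumℤ : List V → (V → ℤ) → ℤ
  sumℤ xs f = foldr (λ x acc → f x ℤ.+ acc) (+ 0) xs

  deg : Divisor → ℤ
  deg D = sumℤ verts D

  Effective : Divisor → Set
  Effective D = ∀ x → + 0 ≤ D x

  Lap : (V → ℤ) → Divisor
  Lap σ x = sumℤ verts (λ y → (+ mult x y) ℤ.* (σ x - σ y))

  _-ᴰ_ : Divisor → Divisor → Divisor
  (D -ᴰ E) x = D x - E x

  EquivEffective : Divisor → Set
  EquivEffective D = Σ (V → ℤ) λ σ → Effective (D -ᴰ Lap σ)

  RankAtLeast : ℕ → Divisor → Set
  RankAtLeast k D = ∀ (E : Divisor) → Effective E → deg E ≡ + k →
                    EquivEffective (D -ᴰ E)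

  HasRank : ℕ → Divisor → Set
  HasRank r D = RankAtLeast r D × ¬ RankAtLeast (suc r) D

  DegIsDgon : ℕ → Divisor → Set
  DegIsDgon r D = HasRank r D × (∀ (D' : Divisor) → HasRank r D' → deg D ≤ deg D')

  SimD : Divisor → V → V → Set
  SimD D u w = ∀ (σ : V → ℤ) → Effective (D -ᴰ Lap σ) → σ u ≡ σ w

data Reach (n m : ℕ) (es : Vec (Fin n × Fin n) m) : Fin n → Fin n → Set where
  here : ∀ {i} → Reach n m es i i
  fwd  : ∀ {i k} (j : Fin m) → proj₁ (lookup es j) ≡ i →
         Reach n m es (proj₂ (lookup es j)) k → Reach n m es i k
  bwd  : ∀ {i k} (j : Fin m) → proj₂ (lookup es j) ≡ i →
         Reach n m es (proj₁ (lookup es j)) k → Reach n m es i k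

Connected : (n m : ℕ) → Vec (Fin n × Fin n) m → Set
Connected n m es = ∀ i k → Reach n m es i k

Loopless : (n m : ℕ) → Vec (Fin n × Fin n) m → Set
Loopless n m es = ∀ (j : Fin m) → ¬ (proj₁ (lookup es j) ≡ proj₂ (lookup es j))

-- ee j false = e_u, ee j true = e_v, where edge j has endpoints (u , v)
data Vx (n m : ℕ) : Set where
  T    : Vx n m
  vtx  : Fin n → Vx n m
  vtx' : Fin n → Vx n m
  tv   : Fin n → Vx n m
  ee   : Fin m → Bool → Vx n m

allVx : (n m : ℕ) → List (Vx n m)
allVx n m = T ∷ map vtx (allFin n) ++ map vtx' (allFin n) ++ map tv (allFin n)
              ++ map (λ j → ee j false) (allFin m) ++ map (λ j → ee j true) (allFin m)

bigM : (n m r : ℕ) → ℕ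
bigM n m r = r ℕ.* (3 ℕ.* n ℕ.+ 2 ℕ.* m ℕ.+ 1) ℕ.+ 1

ifEq : ∀ {k} → Fin k → Fin k → ℕ → ℕ
ifEq i j c with i ≟ᶠ j
... | yes _ = c
... | no _  = 0

endpoint : ∀ {n m} → Vec (Fin n × Fin n) m → Fin m → Bool → Fin n
endpoint es j false = proj₁ (lookup es j)
endpoint es j true  = proj₂ (lookup es j)

multG' : (n m : ℕ) → Vec (Fin n × Fin n) m → ℕ → Vx n m → Vx n m → ℕ
multG' n m es r T        (tv i)   = bigM n m r
multG' n m es r (tv i)   T        = bigM n m r
multG' n m es r (vtx i)  (vtx' k) = ifEq i k (bigM n m r)
multG' n m es r (vtx' i) (vtx k)  = ifEq i k (bigM n m r)
multG' n m es r (vtx' i) (tv k)   = ifEq i k (r ℕ.+ 2)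
multG' n m es r (tv i)   (vtx' k) = ifEq i k (r ℕ.+ 2)
multG' n m es r (vtx i)  (ee j b) = ifEq i (endpoint es j b) (bigM n m r)
multG' n m es r (ee j b) (vtx i)  = ifEq i (endpoint es j b) (bigM n m r)
multG' n m es r (ee j false) (ee k true)  = ifEq j k r
multG' n m es r (ee j true)  (ee k false) = ifEq j k r
multG' n m es r _ _ = 0

G'r : (n m : ℕ) → Vec (Fin n × Fin n) m → ℕ → MGraph
G'r n m es r = record { V = Vx n m ; verts = allVx n m ; mult = multG' n m es r }

-- Write a = D(T_v), b = D(v′), c = r + 2 (the number of edges between v′ and T_v) and M for the
-- multiplicity of the heavy edges. The constant divisor r has rank r and degree M − 1, so deg D < M.
-- If D and D − Lσ are effective and deg D is below the multiplicity of an edge, σ agrees on its ends: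
-- summing Lσ over the upper set {σ ≥ σ y} gives a quantity at most deg D but, if σ x < σ y, at
-- least the multiplicity of xy. Hence σ(T_v) = σ(T) and σ(v′) = σ(v) for every such σ, and then
-- Lσ(T_v) = c·d = −Lσ(v′) with d = σ(T) − σ(v). Removing k chips from T_v and k′ = r − k from v′
-- therefore yields some d with c·d ≤ a − k and −c·d ≤ b − k′. If T ∼_D v, then d = 0, so a, b ≥ r.
-- Otherwise some σ has d ≠ 0, which forces a ≥ c or b ≥ c; if also a + b ≤ 2r, the choice
-- k = a − r − 1 would trap c·d strictly between 0 and c.

module Submission where

module _ where

  open import Defs

  open import Data.Bool using (true; false)
  open import Data.Empty using (⊥; ⊥-elim)
  open import Data.Fin as Fin using (Fin)
  open import Data.Integer using (ℤ; nonNegative; +_; 0ℤ; 1ℤ; -1ℤ; _+_; _-_; _*_; -_; _≤_; _<_; _≤?_; +≤+; +<+)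
  open import Data.Integer.Properties
  open import Data.Integer.Tactic.RingSolver using (solve-∀)
  open import Data.List using (List; []; _∷_; _++_; map; length; allFin)
  open import Data.List.Properties using (length-++; length-map; length-tabulate)
  open import Data.Vec using (Vec)
  open import Data.List.Membership.Propositional using (_∈_)
  open import Data.List.Membership.Propositional.Properties using (∈-map⁺; ∈-++⁺ˡ; ∈-++⁺ʳ; ∈-allFin)
  open import Data.List.Relation.Unary.All as All using (All; []; _∷_)
  import Data.List.Relation.Unary.All.Properties as All
  import Data.List.Relation.Unary.Unique.Propositional.Properties as Unique
  open import Data.List.Relation.Unary.Any using (here; there)
  open import Data.List.Relation.Unary.Unique.Propositional using (Unique; []; _∷_)
  open import Data.Nat as ℕ using (ℕ; suc; z≤n)
  import Data.Nat.Properties as ℕ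
  import Data.Nat.Tactic.RingSolver as ℕS
  open import Data.Product using (∃-syntax; _×_; _,_; proj₁; proj₂)
  open import Function using (_∘_)
  open import Relation.Binary.PropositionalEquality
  open import Relation.Binary.Definitions using (tri<; tri≈; tri>)
  open import Relation.Nullary using (¬_; Dec; yes; no)

  module _ {A : Set} where

    ∑ : List A → (A → ℤ) → ℤ
    ∑ xs f = Data.List.foldr (λ x acc → f x + acc) 0ℤ xs

    ∑-cong : ∀ xs {f g : A → ℤ} → (∀ x → f x ≡ g x) → ∑ xs f ≡ ∑ xs g
    ∑-cong []       eq = refl
    ∑-cong (x ∷ xs) eq = cong₂ _+_ (eq x) (∑-cong xs eq)

    ∑-zero : ∀ xs {f : A → ℤ} → (∀ {x} → x ∈ xs → f x ≡ 0ℤ) → ∑ xs f ≡ 0ℤ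
    ∑-zero []       vanish = refl
    ∑-zero (x ∷ xs) vanish = cong₂ _+_ (vanish (here refl)) (∑-zero xs (vanish ∘ there))

    ∑-+ : ∀ xs (f g : A → ℤ) → ∑ xs (λ x → f x + g x) ≡ ∑ xs f + ∑ xs g
    ∑-+ []       f g = refl
    ∑-+ (x ∷ xs) f g = trans (cong (_+_ (f x + g x)) (∑-+ xs f g)) (+-interchange (f x) (g x) (∑ xs f) (∑ xs g))
      where
      +-interchange : ∀ a b c d → (a + b) + (c + d) ≡ (a + c) + (b + d)
      +-interchange = solve-∀

    ∑-*ˡ : ∀ xs c (f : A → ℤ) → ∑ xs (λ x → c * f x) ≡ c * ∑ xs f
    ∑-*ˡ []       c f = sym (*-zeroʳ c)
    ∑-*ˡ (x ∷ xs) c f = trans (cong (_+_ (c * f x)) (∑-*ˡ xs c f)) (sym (*-distribˡ-+ c (f x) (∑ xs f)))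

    ∑-swap : ∀ xs ys (h : A → A → ℤ) → ∑ xs (λ x → ∑ ys (h x)) ≡ ∑ ys (λ y → ∑ xs (λ x → h x y))
    ∑-swap []       ys h = sym (∑-zero ys (λ _ → refl))
    ∑-swap (x ∷ xs) ys h = trans (cong (_+_ (∑ ys (h x))) (∑-swap xs ys h)) (sym (∑-+ ys (h x) _))

    ∑-const : ∀ xs c → ∑ xs (λ _ → + c) ≡ + (length xs ℕ.* c)
    ∑-const []       c = refl
    ∑-const (x ∷ xs) c = cong (_+_ (+ c)) (∑-const xs c)

    ∑-mono-≤ : ∀ xs {f g : A → ℤ} → (∀ x → f x ≤ g x) → ∑ xs f ≤ ∑ xs g
    ∑-mono-≤ []       f≤g = ≤-refl
    ∑-mono-≤ (x ∷ xs) f≤g = +-mono-≤ (f≤g x) (∑-mono-≤ xs f≤g)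

    module _ {f : A → ℤ} (f≥0 : ∀ x → 0ℤ ≤ f x) where

      ∑-nonNeg : ∀ xs → 0ℤ ≤ ∑ xs f
      ∑-nonNeg []       = ≤-refl
      ∑-nonNeg (x ∷ xs) = +-mono-≤ (f≥0 x) (∑-nonNeg xs)

      ∑-≥-term : ∀ {xs a} → a ∈ xs → f a ≤ ∑ xs f
      ∑-≥-term {x ∷ xs} (here refl) = i≤i+j (f x) _ {{nonNegative (∑-nonNeg xs)}}
      ∑-≥-term {x ∷ xs} (there a∈xs) = ≤-trans (∑-≥-term a∈xs) (i≤j+i _ (f x) {{nonNegative (f≥0 x)}})

      ∑-≥-two-terms : ∀ {xs a b} → a ∈ xs → b ∈ xs → a ≢ b → f a + f b ≤ ∑ xs f
      ∑-≥-two-terms (here refl) (here refl) a≢b = ⊥-elim (a≢b refl)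
      ∑-≥-two-terms {a = a} (here refl) (there b∈xs) _ = +-monoʳ-≤ (f a) (∑-≥-term b∈xs)
      ∑-≥-two-terms {a = a} {b} (there a∈xs) (here refl) _ =
        ≤-trans (≤-reflexive (+-comm (f a) (f b))) (+-monoʳ-≤ (f b) (∑-≥-term a∈xs))
      ∑-≥-two-terms {x ∷ _} (there a∈xs) (there b∈xs) a≢b =
        ≤-trans (∑-≥-two-terms a∈xs b∈xs a≢b) (i≤j+i _ (f x) {{nonNegative (f≥0 x)}})

    ∑-supported : ∀ {xs a} {f : A → ℤ} → Unique xs → a ∈ xs →
                  (∀ {x} → x ∈ xs → x ≢ a → f x ≡ 0ℤ) → ∑ xs f ≡ f a
    ∑-supported {x ∷ xs} {f = f} (x∉xs ∷ _) (here refl) vanish =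
      trans (cong (_+_ (f x)) (∑-zero xs (λ y∈xs → vanish (there y∈xs) (≢-sym (All.lookup x∉xs y∈xs)))))
            (+-identityʳ (f x))
    ∑-supported {x ∷ xs} {f = f} (x∉xs ∷ u) (there a∈xs) vanish =
      trans (cong (_+ ∑ xs f) (vanish (here refl) (All.lookup x∉xs a∈xs)))
            (trans (+-identityˡ _) (∑-supported u a∈xs (vanish ∘ there)))

    ∑-supported₂ : ∀ {xs a b} {f : A → ℤ} → Unique xs → a ∈ xs → b ∈ xs → a ≢ b →
                   (∀ {x} → x ∈ xs → x ≢ a → x ≢ b → f x ≡ 0ℤ) → ∑ xs f ≡ f a + f b
    ∑-supported₂ _ (here refl) (here refl) a≢b _ = ⊥-elim (a≢b refl)
    ∑-supported₂ {x ∷ xs} {f = f} (x∉xs ∷ u) (here refl) (there b∈xs) _ vanish =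
      cong (_+_ (f x)) (∑-supported u b∈xs (λ y∈xs → vanish (there y∈xs) (≢-sym (All.lookup x∉xs y∈xs))))
    ∑-supported₂ {x ∷ xs} {a} {f = f} (x∉xs ∷ u) (there a∈xs) (here refl) _ vanish =
      trans (cong (_+_ (f x)) (∑-supported u a∈xs (λ y∈xs y≢a → vanish (there y∈xs) y≢a (≢-sym (All.lookup x∉xs y∈xs)))))
            (+-comm (f x) (f a))
    ∑-supported₂ {x ∷ xs} {f = f} (x∉xs ∷ u) (there a∈xs) (there b∈xs) a≢b vanish =
      trans (cong (_+ ∑ xs f) (vanish (here refl) (All.lookup x∉xs a∈xs) (All.lookup x∉xs b∈xs)))
            (trans (+-identityˡ _) (∑-supported₂ u a∈xs b∈xs a≢b (vanish ∘ there)))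

  ⟦_⟧ : {P : Set} → Dec P → ℤ
  ⟦ yes _ ⟧ = 1ℤ
  ⟦ no _ ⟧  = 0ℤ

  ⟦yes⟧ : {P : Set} → P → (d : Dec P) → ⟦ d ⟧ ≡ 1ℤ
  ⟦yes⟧ p (yes _) = refl
  ⟦yes⟧ p (no ¬p) = ⊥-elim (¬p p)

  ⟦no⟧ : {P : Set} → ¬ P → (d : Dec P) → ⟦ d ⟧ ≡ 0ℤ
  ⟦no⟧ ¬p (yes p) = ⊥-elim (¬p p)
  ⟦no⟧ ¬p (no _)  = refl

  -1*-flip : ∀ k a b → (0ℤ - 1ℤ) * (k * (a - b)) ≡ k * (b - a)
  -1*-flip = solve-∀

  -[i-j]≡j-i : ∀ i j → - (i - j) ≡ j - i
  -[i-j]≡j-i = solve-∀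

  +k*-nonNeg : ∀ k {d} → 0ℤ ≤ d → 0ℤ ≤ + k * d
  +k*-nonNeg k {d} 0≤d = ≤-trans (≤-reflexive (sym (*-zeroʳ (+ k)))) (*-monoˡ-≤-nonNeg (+ k) 0≤d)

  i<j⇒1≤j-i : ∀ {a b} → a < b → 1ℤ ≤ b - a
  i<j⇒1≤j-i {a} a<b = ≤-trans (≤-reflexive (sym (cancel a))) (+-monoˡ-≤ (- a) (i<j⇒suc[i]≤j a<b))
    where
    cancel : ∀ a → (1ℤ + a) - a ≡ 1ℤ
    cancel = solve-∀

  +k≤+k*[b-a] : ∀ k {a b} → a < b → + k ≤ + k * (b - a)
  +k≤+k*[b-a] k a<b = ≤-trans (≤-reflexive (sym (*-identityʳ (+ k)))) (*-monoˡ-≤-nonNeg (+ k) (i<j⇒1≤j-i a<b))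

  upperSet-flow-nonNeg : ∀ t a b k → 0ℤ ≤ (⟦ t ≤? a ⟧ - ⟦ t ≤? b ⟧) * (+ k * (a - b))
  upperSet-flow-nonNeg t a b k with t ≤? a | t ≤? b
  ... | yes _   | yes _   = ≤-refl
  ... | no _    | no _    = ≤-refl
  ... | yes t≤a | no t≰b  =
    ≤-trans (+k*-nonNeg k (i≤j⇒0≤j-i (≤-trans (<⇒≤ (≰⇒> t≰b)) t≤a))) (≤-reflexive (sym (*-identityˡ _)))
  ... | no t≰a  | yes t≤b =
    ≤-trans (+k*-nonNeg k (i≤j⇒0≤j-i (≤-trans (<⇒≤ (≰⇒> t≰a)) t≤b))) (≤-reflexive (sym (-1*-flip (+ k) a b)))

  upperSet-flow-in : ∀ k {a b} → a < b → + k ≤ (⟦ b ≤? a ⟧ - ⟦ b ≤? b ⟧) * (+ k * (a - b))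
  upperSet-flow-in k {a} {b} a<b = ≤-trans (+k≤+k*[b-a] k a<b) (≤-reflexive (sym (begin
    (⟦ b ≤? a ⟧ - ⟦ b ≤? b ⟧) * (+ k * (a - b))  ≡⟨ cong₂ (λ p q → (p - q) * (+ k * (a - b))) (⟦no⟧ (<⇒≱ a<b) (b ≤? a)) (⟦yes⟧ ≤-refl (b ≤? b)) ⟩
    (0ℤ - 1ℤ) * (+ k * (a - b))                   ≡⟨ -1*-flip (+ k) a b ⟩
    + k * (b - a)                                  ∎)))
    where open ≡-Reasoning

  upperSet-flow-out : ∀ k {a b} → a < b → + k ≤ (⟦ b ≤? b ⟧ - ⟦ b ≤? a ⟧) * (+ k * (b - a))
  upperSet-flow-out k {a} {b} a<b = ≤-trans (+k≤+k*[b-a] k a<b) (≤-reflexive (sym (begin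
    (⟦ b ≤? b ⟧ - ⟦ b ≤? a ⟧) * (+ k * (b - a))  ≡⟨ cong₂ (λ p q → (p - q) * (+ k * (b - a))) (⟦yes⟧ ≤-refl (b ≤? b)) (⟦no⟧ (<⇒≱ a<b) (b ≤? a)) ⟩
    1ℤ * (+ k * (b - a))                          ≡⟨ *-identityˡ _ ⟩
    + k * (b - a)                                  ∎)))
    where open ≡-Reasoning

  +k*[a-b]≡0 : ∀ k {a b} → a ≡ b → + k * (a - b) ≡ 0ℤ
  +k*[a-b]≡0 k {a} refl = trans (cong (+ k *_) (+-inverseʳ a)) (*-zeroʳ (+ k))

  module DivisorLemmas (G : MGraph) where
    open MGraph G
    open DivisorTheory G

    Lap-const : ∀ t x → Lap (λ _ → t) x ≡ 0ℤ
    Lap-const t x = ∑-zero verts (λ {y} _ → +k*[a-b]≡0 (mult x y) {t} refl)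

    Effective-unsubtract : ∀ {D E σ} → Effective E → Effective ((D -ᴰ E) -ᴰ Lap σ) → Effective (D -ᴰ Lap σ)
    Effective-unsubtract {D} {E} {σ} E≥0 D-E-Lσ≥0 x =
      ≤-trans (+-mono-≤ (D-E-Lσ≥0 x) (E≥0 x)) (≤-reflexive (cancel (D x) (E x) (Lap σ x)))
      where
      cancel : ∀ d e l → ((d - e) - l) + e ≡ d - l
      cancel = solve-∀

    ∑-upperSet-Lap≤deg : ∀ {D σ} t → Effective D → Effective (D -ᴰ Lap σ) →
                         ∑ verts (λ z → ⟦ t ≤? σ z ⟧ * Lap σ z) ≤ deg D
    ∑-upperSet-Lap≤deg {D} {σ} t D≥0 D-Lσ≥0 = ∑-mono-≤ verts pointwise
      where
      pointwise : ∀ z → ⟦ t ≤? σ z ⟧ * Lap σ z ≤ D z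
      pointwise z with t ≤? σ z
      ... | yes _ = ≤-trans (≤-reflexive (*-identityˡ _)) (0≤i-j⇒j≤i (D-Lσ≥0 z))
      ... | no _  = D≥0 z

    module _ (∈-verts : ∀ x → x ∈ verts) where

      rankAtLeast-const : ∀ k → RankAtLeast k (λ _ → + k)
      rankAtLeast-const k E E≥0 degE≡k = (λ _ → 0ℤ) , λ x →
        ≤-trans (i≤j⇒0≤j-i (subst (E x ≤_) degE≡k (∑-≥-term E≥0 (∈-verts x))))
                (≤-reflexive (sym (trans (cong (_-_ (+ k - E x)) (Lap-const 0ℤ x)) (+-identityʳ _))))

      module _ (mult-sym : ∀ x y → mult x y ≡ mult y x) where

        flow : (V → ℤ) → V → V → ℤ
        flow σ z w = + mult z w * (σ z - σ w)

        flow-antisym : ∀ σ z w → flow σ w z ≡ - flow σ z w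
        flow-antisym σ z w rewrite mult-sym w z = negate (+ mult z w) (σ z) (σ w)
          where
          negate : ∀ k a b → k * (b - a) ≡ - (k * (a - b))
          negate = solve-∀

        ∑-weighted-Lap-twice : ∀ σ (χ : V → ℤ) →
          ∑ verts (λ z → χ z * Lap σ z) + ∑ verts (λ z → χ z * Lap σ z)
            ≡ ∑ verts (λ z → ∑ verts (λ w → (χ z - χ w) * flow σ z w))
        ∑-weighted-Lap-twice σ χ = begin
          Q + Q
            ≡⟨ cong₂ _+_ Q≡∑∑ Q≡-∑∑ ⟩
          ∑ verts (λ z → ∑ verts (λ w → χ z * flow σ z w)) + ∑ verts (λ z → ∑ verts (λ w → - (χ w * flow σ z w)))
            ≡⟨ sym (∑-+ verts (λ z → ∑ verts (λ w → χ z * flow σ z w)) (λ z → ∑ verts (λ w → - (χ w * flow σ z w)))) ⟩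
          ∑ verts (λ z → ∑ verts (λ w → χ z * flow σ z w) + ∑ verts (λ w → - (χ w * flow σ z w)))
            ≡⟨ ∑-cong verts (λ z → sym (∑-+ verts (λ w → χ z * flow σ z w) (λ w → - (χ w * flow σ z w)))) ⟩
          ∑ verts (λ z → ∑ verts (λ w → χ z * flow σ z w + - (χ w * flow σ z w)))
            ≡⟨ ∑-cong verts (λ z → ∑-cong verts (λ w → factor (χ z) (χ w) (flow σ z w))) ⟩
          ∑ verts (λ z → ∑ verts (λ w → (χ z - χ w) * flow σ z w)) ∎
          where
          open ≡-Reasoning
          Q : ℤ
          Q = ∑ verts (λ z → χ z * Lap σ z)
          factor : ∀ a b f → a * f + - (b * f) ≡ (a - b) * f
          factor = solve-∀
          Q≡∑∑ : Q ≡ ∑ verts (λ z → ∑ verts (λ w → χ z * flow σ z w))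
          Q≡∑∑ = ∑-cong verts (λ z → sym (∑-*ˡ verts (χ z) (flow σ z)))
          Q≡-∑∑ : Q ≡ ∑ verts (λ z → ∑ verts (λ w → - (χ w * flow σ z w)))
          Q≡-∑∑ = trans Q≡∑∑ (trans (∑-swap verts verts (λ z w → χ z * flow σ z w))
                    (∑-cong verts (λ w → ∑-cong verts (λ z →
                      trans (cong (χ z *_) (flow-antisym σ w z)) (sym (neg-distribʳ-* (χ z) (flow σ w z)))))))

        -- χ is the indicator of {z | σ y ≤ σ z}; antisymmetry of the flow doubles ∑ χ·Lσ into a sum
        -- of nonnegative terms, two of which are at least mult x y when σ x < σ y.
        σ-≤-across-thick-edge : ∀ {D σ x y} → Effective D → Effective (D -ᴰ Lap σ) → x ≢ y →
                                deg D < + mult x y → σ y ≤ σ x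
        σ-≤-across-thick-edge {D} {σ} {x} {y} D≥0 D-Lσ≥0 x≢y deg<k with σ y ≤? σ x
        ... | yes σy≤σx = σy≤σx
        ... | no σy≰σx  = ⊥-elim (<-irrefl refl (≤-<-trans chain (+-mono-< deg<k deg<k)))
          where
          open ≤-Reasoning
          χ : V → ℤ
          χ z = ⟦ σ y ≤? σ z ⟧
          h : V → V → ℤ
          h z w = (χ z - χ w) * flow σ z w
          h≥0 : ∀ z w → 0ℤ ≤ h z w
          h≥0 z w = upperSet-flow-nonNeg (σ y) (σ z) (σ w) (mult z w)
          hyx≥k : + mult x y ≤ h y x
          hyx≥k = subst (λ k → + k ≤ h y x) (mult-sym y x) (upperSet-flow-out (mult y x) (≰⇒> σy≰σx))
          Q≤deg : ∑ verts (λ z → χ z * Lap σ z) ≤ deg D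
          Q≤deg = ∑-upperSet-Lap≤deg (σ y) D≥0 D-Lσ≥0
          chain : + mult x y + + mult x y ≤ deg D + deg D
          chain = begin
            + mult x y + + mult x y          ≤⟨ +-mono-≤ (upperSet-flow-in (mult x y) (≰⇒> σy≰σx)) hyx≥k ⟩
            h x y + h y x                    ≤⟨ +-mono-≤ (∑-≥-term (h≥0 x) (∈-verts y)) (∑-≥-term (h≥0 y) (∈-verts x)) ⟩
            ∑ verts (h x) + ∑ verts (h y)    ≤⟨ ∑-≥-two-terms (λ z → ∑-nonNeg (h≥0 z) verts) (∈-verts x) (∈-verts y) x≢y ⟩
            ∑ verts (λ z → ∑ verts (h z))     ≡⟨ sym (∑-weighted-Lap-twice σ χ) ⟩
            ∑ verts (λ z → χ z * Lap σ z) + ∑ verts (λ z → χ z * Lap σ z)  ≤⟨ +-mono-≤ Q≤deg Q≤deg ⟩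
            deg D + deg D                    ∎

        σ-equal-across-thick-edge : ∀ {D σ x y} → Effective D → Effective (D -ᴰ Lap σ) → x ≢ y →
                                    deg D < + mult x y → σ x ≡ σ y
        σ-equal-across-thick-edge {D} {σ} {x} {y} D≥0 D-Lσ≥0 x≢y deg<k =
          ≤-antisym (σ-≤-across-thick-edge D≥0 D-Lσ≥0 (≢-sym x≢y) (subst (λ k → deg D < + k) (mult-sym x y) deg<k))
                    (σ-≤-across-thick-edge D≥0 D-Lσ≥0 x≢y deg<k)

  no-multiple-in-gap : ∀ r d → 1ℤ ≤ + (r ℕ.+ 2) * d → + (r ℕ.+ 2) * d ≤ + suc r → ⊥
  no-multiple-in-gap r d 1≤cd cd≤r+1 with d ≤? 0ℤ
  ... | yes d≤0 = 1≰0 (≤-trans 1≤cd (≤-trans (*-monoˡ-≤-nonNeg c d≤0) (≤-reflexive (*-zeroʳ c))))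
    where
    c = + (r ℕ.+ 2)
    1≰0 : ¬ 1ℤ ≤ 0ℤ
    1≰0 (+≤+ ())
  ... | no d≰0 = ℕ.1+n≰n (subst (ℕ._≤ suc r) (ℕ.+-comm r 2) (drop‿+≤+ c≤r+1))
    where
    c = + (r ℕ.+ 2)
    c≤r+1 : c ≤ + suc r
    c≤r+1 = ≤-trans (≤-reflexive (sym (*-identityʳ c))) (≤-trans (*-monoˡ-≤-nonNeg c (i<j⇒suc[i]≤j (≰⇒> d≰0))) cd≤r+1)

  window-split : ∀ {r A B} → suc r ℕ.≤ A → A ℕ.+ B ℕ.≤ 2 ℕ.* r →
                 ∃[ k ] ∃[ k′ ] (k ℕ.+ k′ ≡ r × suc r ℕ.+ k ≡ A × B ℕ.< k′)
  window-split {r} {A} {B} r<A A+B≤2r with ℕ.m≤n⇒∃[o]m+o≡n r<A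
  ... | k , refl with ℕ.m≤n⇒∃[o]m+o≡n k+B<r
    where
    k+B<r : suc (k ℕ.+ B) ℕ.≤ r
    k+B<r = ℕ.+-cancelˡ-≤ r _ _ (subst₂ ℕ._≤_ (reassoc r k B) (double r) A+B≤2r)
      where
      reassoc : ∀ r k B → suc r ℕ.+ k ℕ.+ B ≡ r ℕ.+ suc (k ℕ.+ B)
      reassoc = ℕS.solve-∀
      double : ∀ r → 2 ℕ.* r ≡ r ℕ.+ r
      double = ℕS.solve-∀
  ...   | j , refl = k , suc B ℕ.+ j , reassoc k B j , refl , ℕ.s≤s (ℕ.m≤m+n B j)
    where
    reassoc : ∀ k B j → k ℕ.+ (suc B ℕ.+ j) ≡ suc (k ℕ.+ B) ℕ.+ j
    reassoc = ℕS.solve-∀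

  -- What the rank condition says about a = D(T_v) and b = D(v′), with d standing for σ(T) − σ(v).
  Splittable : ℕ → ℤ → ℤ → Set
  Splittable r a b = ∀ k k′ → k ℕ.+ k′ ≡ r →
    ∃[ d ] (+ (r ℕ.+ 2) * d ≤ a - + k) × (+ (r ℕ.+ 2) * (- d) ≤ b - + k′)

  Splittable-sym : ∀ {r a b} → Splittable r a b → Splittable r b a
  Splittable-sym {r} {a} split k k′ k+k′≡r with split k′ k (trans (ℕ.+-comm k′ k) k+k′≡r)
  ... | d , cd≤a-k′ , c[-d]≤b-k =
    - d , c[-d]≤b-k , subst (λ e → + (r ℕ.+ 2) * e ≤ a - + k′) (sym (neg-involutive d)) cd≤a-k′

  -- If a + b ≤ 2r, then k = a − r − 1 and k′ = r − k give c·d ≤ r + 1 < c and c·d ≥ k′ − b ≥ 1.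
  Splittable⇒2r<a+b : ∀ {r a b} → Splittable r a b → + suc r ≤ a → 0ℤ ≤ b → + (2 ℕ.* r) < a + b
  Splittable⇒2r<a+b {r} {+ A} {+ B} split (+≤+ r<A) _ with + A + + B ≤? + (2 ℕ.* r)
  ... | no a+b≰2r = ≰⇒> a+b≰2r
  ... | yes (+≤+ A+B≤2r) with window-split r<A A+B≤2r
  ...   | k , k′ , k+k′≡r , refl , B<k′ with split k k′ k+k′≡r
  ...     | d , cd≤a-k , c[-d]≤b-k′ = ⊥-elim (no-multiple-in-gap r d 1≤cd cd≤r+1)
    where
    c = + (r ℕ.+ 2)
    cd≤r+1 : c * d ≤ + suc r
    cd≤r+1 = ≤-trans cd≤a-k (≤-reflexive (trans (cong (_- + k) (pos-+ (suc r) k)) (cancel (+ suc r) (+ k))))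
      where
      cancel : ∀ x y → (x + y) - y ≡ x
      cancel = solve-∀
    1≤cd : 1ℤ ≤ c * d
    1≤cd = ≤-trans (i<j⇒1≤j-i (+<+ B<k′))
                   (≤-trans (≤-reflexive (sym (-[i-j]≡j-i (+ B) (+ k′)))) (≤-trans (neg-mono-≤ c[-d]≤b-k′) (≤-reflexive (negate-neg c d))))
      where
      negate-neg : ∀ c d → - (c * (- d)) ≡ c * d
      negate-neg = solve-∀

  module _ {A : Set} (level : A → ℕ) where

    Level : ℕ → List A → Set
    Level k xs = Unique xs × All (λ x → level x ≡ k) xs

    Layered : ℕ → List A → Set
    Layered k xs = Unique xs × All (λ x → k ℕ.≤ level x) xs

    Level⇒Layered : ∀ {k xs} → Level k xs → Layered k xs
    Level⇒Layered (u , lv) = u , All.map (ℕ.≤-reflexive ∘ sym) lv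

    Layered-++ : ∀ {k xs ys} → Level k xs → Layered (suc k) ys → Layered k (xs ++ ys)
    Layered-++ {k} (uxs , lvxs) (uys , lvys) =
      Unique.++⁺ uxs uys (λ (v∈xs , v∈ys) → ℕ.1+n≰n (subst (suc k ℕ.≤_) (All.lookup lvxs v∈xs) (All.lookup lvys v∈ys))) ,
      All.++⁺ (All.map (ℕ.≤-reflexive ∘ sym) lvxs) (All.map ℕ.<⇒≤ lvys)

    Level-map-allFin : ∀ {k ℓ} (g : Fin ℓ → A) → (∀ {i j} → g i ≡ g j → i ≡ j) → (∀ i → level (g i) ≡ k) →
                       Level k (map g (allFin ℓ))
    Level-map-allFin {ℓ = ℓ} g g-inj lv = Unique.map⁺ g-inj (Unique.allFin⁺ ℓ) , All.map⁺ (All.universal lv (allFin ℓ))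

  ∈-map-allFin : ∀ {A : Set} {ℓ} (g : Fin ℓ → A) i → g i ∈ map g (allFin ℓ)
  ∈-map-allFin g i = ∈-map⁺ g (∈-allFin i)

  ifEq-refl : ∀ {k} (i : Fin k) c → ifEq i i c ≡ c
  ifEq-refl i c with i Fin.≟ i
  ... | yes _  = refl
  ... | no i≢i = ⊥-elim (i≢i refl)

  ifEq-≢ : ∀ {k} {i j : Fin k} c → i ≢ j → ifEq i j c ≡ 0
  ifEq-≢ {i = i} {j} c i≢j with i Fin.≟ j
  ... | yes i≡j = ⊥-elim (i≢j i≡j)
  ... | no _    = refl

  ifEq-sym : ∀ {k} (i j : Fin k) c → ifEq i j c ≡ ifEq j i c
  ifEq-sym i j c with i Fin.≟ j
  ... | yes refl = sym (ifEq-refl i c)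
  ... | no i≢j   = sym (ifEq-≢ c (≢-sym i≢j))

  ifEq-term≡0 : ∀ {ℓ} {i j : Fin ℓ} c {a b} → (i ≡ j → a ≡ b) → + ifEq i j c * (a - b) ≡ 0ℤ
  ifEq-term≡0 {i = i} {j} c i≡j⇒a≡b with i Fin.≟ j
  ... | yes i≡j = +k*[a-b]≡0 c (i≡j⇒a≡b i≡j)
  ... | no _    = refl

  module G'ᵣ (n m : ℕ) (es : Vec (Fin n × Fin n) m) (r : ℕ) where
    open MGraph (G'r n m es r)
    open DivisorTheory (G'r n m es r)
    open DivisorLemmas (G'r n m es r)

    c : ℕ
    c = r ℕ.+ 2

    mult-sym : ∀ x y → mult x y ≡ mult y x
    mult-sym T            T            = refl
    mult-sym T            (vtx _)      = refl
    mult-sym T            (vtx' _)     = refl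
    mult-sym T            (tv _)       = refl
    mult-sym T            (ee _ _)     = refl
    mult-sym (vtx _)      T            = refl
    mult-sym (vtx _)      (vtx _)      = refl
    mult-sym (vtx i)      (vtx' j)     = ifEq-sym i j _
    mult-sym (vtx _)      (tv _)       = refl
    mult-sym (vtx _)      (ee _ _)     = refl
    mult-sym (vtx' _)     T            = refl
    mult-sym (vtx' i)     (vtx j)      = ifEq-sym i j _
    mult-sym (vtx' _)     (vtx' _)     = refl
    mult-sym (vtx' i)     (tv j)       = ifEq-sym i j _
    mult-sym (vtx' _)     (ee _ _)     = refl
    mult-sym (tv _)       T            = refl
    mult-sym (tv _)       (vtx _)      = refl
    mult-sym (tv i)       (vtx' j)     = ifEq-sym i j _
    mult-sym (tv _)       (tv _)       = refl
    mult-sym (tv _)       (ee _ _)     = refl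
    mult-sym (ee _ _)     T            = refl
    mult-sym (ee _ _)     (vtx _)      = refl
    mult-sym (ee _ _)     (vtx' _)     = refl
    mult-sym (ee _ _)     (tv _)       = refl
    mult-sym (ee _ false) (ee _ false) = refl
    mult-sym (ee i false) (ee j true)  = ifEq-sym i j _
    mult-sym (ee i true)  (ee j false) = ifEq-sym i j _
    mult-sym (ee _ true)  (ee _ true)  = refl

    level : Vx n m → ℕ
    level T            = 0
    level (vtx _)      = 1
    level (vtx' _)     = 2
    level (tv _)       = 3
    level (ee _ false) = 4
    level (ee _ true)  = 5

    allVx-unique : Unique verts
    allVx-unique = proj₁ (Layered-++ level (([] ∷ []) , (refl ∷ []))
      (Layered-++ level (Level-map-allFin level vtx (λ { refl → refl }) (λ _ → refl))
      (Layered-++ level (Level-map-allFin level vtx' (λ { refl → refl }) (λ _ → refl))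
      (Layered-++ level (Level-map-allFin level tv (λ { refl → refl }) (λ _ → refl))
      (Layered-++ level (Level-map-allFin level (λ j → ee j false) (λ { refl → refl }) (λ _ → refl))
      (Level⇒Layered level (Level-map-allFin level (λ j → ee j true) (λ { refl → refl }) (λ _ → refl))))))))

    ∈-allVx : ∀ x → x ∈ verts
    ∈-allVx T            = here refl
    ∈-allVx (vtx i)      = there (∈-++⁺ˡ (∈-map-allFin vtx i))
    ∈-allVx (vtx' i)     = there (∈-++⁺ʳ (map vtx (allFin n)) (∈-++⁺ˡ (∈-map-allFin vtx' i)))
    ∈-allVx (tv i)       = there (∈-++⁺ʳ (map vtx (allFin n)) (∈-++⁺ʳ (map vtx' (allFin n)) (∈-++⁺ˡ (∈-map-allFin tv i))))
    ∈-allVx (ee j false) = there (∈-++⁺ʳ (map vtx (allFin n)) (∈-++⁺ʳ (map vtx' (allFin n)) (∈-++⁺ʳ (map tv (allFin n))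
                             (∈-++⁺ˡ (∈-map-allFin (λ j → ee j false) j)))))
    ∈-allVx (ee j true)  = there (∈-++⁺ʳ (map vtx (allFin n)) (∈-++⁺ʳ (map vtx' (allFin n)) (∈-++⁺ʳ (map tv (allFin n))
                             (∈-++⁺ʳ (map (λ j → ee j false) (allFin m)) (∈-map-allFin (λ j → ee j true) j)))))

    Lap-T : ∀ σ → (∀ i → σ (tv i) ≡ σ T) → Lap σ T ≡ 0ℤ
    Lap-T σ σtv≡σT = ∑-zero verts (λ {y} _ → term y)
      where
      term : ∀ y → + mult T y * (σ T - σ y) ≡ 0ℤ
      term T        = refl
      term (vtx _)  = refl
      term (vtx' _) = refl
      term (tv i)   = +k*[a-b]≡0 (bigM n m r) (sym (σtv≡σT i))
      term (ee _ _) = refl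

    module _ (σ : Vx n m → ℤ) (v : Fin n) (σtv≡σT : σ (tv v) ≡ σ T) (σv′≡σv : σ (vtx' v) ≡ σ (vtx v)) where

      Lap-tv : Lap σ (tv v) ≡ + c * (σ T - σ (vtx v))
      Lap-tv = trans (∑-supported allVx-unique (∈-allVx (vtx' v)) (λ {y} _ → term y))
                     (cong₂ (λ k d → + k * d) (ifEq-refl v c) (cong₂ _-_ σtv≡σT σv′≡σv))
        where
        term : ∀ y → y ≢ vtx' v → + mult (tv v) y * (σ (tv v) - σ y) ≡ 0ℤ
        term T        _     = +k*[a-b]≡0 (bigM n m r) σtv≡σT
        term (vtx _)  _     = refl
        term (vtx' i) y≢vtx'v = ifEq-term≡0 {i = v} {i} c {σ (tv v)} {σ (vtx' i)} (λ { refl → ⊥-elim (y≢vtx'v refl) })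
        term (tv _)   _     = refl
        term (ee _ _) _     = refl

      Lap-vtx' : Lap σ (vtx' v) ≡ + c * (σ (vtx v) - σ T)
      Lap-vtx' = trans (∑-supported allVx-unique (∈-allVx (tv v)) (λ {y} _ → term y))
                       (cong₂ (λ k d → + k * d) (ifEq-refl v c) (cong₂ _-_ σv′≡σv σtv≡σT))
        where
        term : ∀ y → y ≢ tv v → + mult (vtx' v) y * (σ (vtx' v) - σ y) ≡ 0ℤ
        term T        _      = refl
        term (vtx i)  _      = ifEq-term≡0 {i = v} {i} (bigM n m r) {σ (vtx' v)} {σ (vtx i)} (λ { refl → σv′≡σv })
        term (vtx' _) _      = refl
        term (tv i)   y≢tv-v = ifEq-term≡0 {i = v} {i} c {σ (vtx' v)} {σ (tv i)} (λ { refl → ⊥-elim (y≢tv-v refl) })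
        term (ee _ _) _      = refl

      Lap-bounds : ∀ F → Effective (F -ᴰ Lap σ) →
                   (+ c * (σ T - σ (vtx v)) ≤ F (tv v)) × (+ c * (σ (vtx v) - σ T) ≤ F (vtx' v))
      Lap-bounds F F-Lσ≥0 = 0≤i-j⇒j≤i (subst (λ L → 0ℤ ≤ F (tv v) - L) Lap-tv (F-Lσ≥0 (tv v))) ,
                              0≤i-j⇒j≤i (subst (λ L → 0ℤ ≤ F (vtx' v) - L) Lap-vtx' (F-Lσ≥0 (vtx' v)))

    length-allVx : length verts ≡ suc (n ℕ.+ (n ℕ.+ (n ℕ.+ (m ℕ.+ m))))
    length-allVx =
      cong suc (trans (length-++ (map vtx (allFin n))) (cong₂ ℕ._+_ (length-map-allFin vtx)
               (trans (length-++ (map vtx' (allFin n))) (cong₂ ℕ._+_ (length-map-allFin vtx')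
               (trans (length-++ (map tv (allFin n))) (cong₂ ℕ._+_ (length-map-allFin tv)
               (trans (length-++ (map (λ j → ee j false) (allFin m)))
                      (cong₂ ℕ._+_ (length-map-allFin (λ j → ee j false)) (length-map-allFin (λ j → ee j true))))))))))
      where
      length-map-allFin : ∀ {ℓ} (g : Fin ℓ → Vx n m) → length (map g (allFin ℓ)) ≡ ℓ
      length-map-allFin g = trans (length-map g (allFin _)) (length-tabulate (λ i → i))

    -- M = r·|V| + 1 is one more than the degree of the constant divisor r.
    deg-const<M : deg (λ _ → + r) < + bigM n m r
    deg-const<M = subst (_< + bigM n m r) (sym (trans (∑-const verts r) (cong (λ ℓ → + (ℓ ℕ.* r)) length-allVx)))
                        (+<+ (ℕ.≤-reflexive (count n m r)))
      where
      count : ∀ n m r → suc (suc (n ℕ.+ (n ℕ.+ (n ℕ.+ (m ℕ.+ m)))) ℕ.* r) ≡ r ℕ.* (3 ℕ.* n ℕ.+ 2 ℕ.* m ℕ.+ 1) ℕ.+ 1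
      count = ℕS.solve-∀

    chipsOnT : ℕ → Vx n m → ℕ
    chipsOnT k T = k
    chipsOnT k _ = 0

    chipsOnTv+v′ : Fin n → ℕ → ℕ → Vx n m → ℕ
    chipsOnTv+v′ v k k′ (tv i)   = ifEq v i k
    chipsOnTv+v′ v k k′ (vtx' i) = ifEq v i k′
    chipsOnTv+v′ v k k′ _        = 0

    deg-chipsOnT : ∀ k → deg (+_ ∘ chipsOnT k) ≡ + k
    deg-chipsOnT k = ∑-supported allVx-unique (∈-allVx T) (λ {y} _ → off-T y)
      where
      off-T : ∀ y → y ≢ T → + chipsOnT k y ≡ 0ℤ
      off-T T        y≢T = ⊥-elim (y≢T refl)
      off-T (vtx _)  _   = refl
      off-T (vtx' _) _   = refl
      off-T (tv _)   _   = refl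
      off-T (ee _ _) _   = refl

    deg-chipsOnTv+v′ : ∀ v k k′ → deg (+_ ∘ chipsOnTv+v′ v k k′) ≡ + (k ℕ.+ k′)
    deg-chipsOnTv+v′ v k k′ =
      trans (∑-supported₂ allVx-unique (∈-allVx (tv v)) (∈-allVx (vtx' v)) (λ ()) (λ {y} _ → off-support y))
            (cong₂ (λ p q → + p + + q) (ifEq-refl v k) (ifEq-refl v k′))
      where
      off-support : ∀ y → y ≢ tv v → y ≢ vtx' v → + chipsOnTv+v′ v k k′ y ≡ 0ℤ
      off-support T        _ _ = refl
      off-support (vtx _)  _ _ = refl
      off-support (vtx' i) _ y≢vtx'v = cong +_ (ifEq-≢ k′ (λ { refl → y≢vtx'v refl }))
      off-support (tv i)   y≢tv-v _  = cong +_ (ifEq-≢ k (λ { refl → y≢tv-v refl }))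
      off-support (ee _ _) _ _ = refl

    module _ {D : Divisor} (D≥0 : Effective D) (deg<M : deg D < + bigM n m r)
             (σ : Vx n m → ℤ) (valid : Effective (D -ᴰ Lap σ)) where

      σ-tv≡σ-T : ∀ i → σ (tv i) ≡ σ T
      σ-tv≡σ-T i = σ-equal-across-thick-edge ∈-allVx mult-sym {D} {σ} {tv i} {T} D≥0 valid (λ ()) deg<M

      σ-v′≡σ-v : ∀ i → σ (vtx' i) ≡ σ (vtx i)
      σ-v′≡σ-v i = σ-equal-across-thick-edge ∈-allVx mult-sym {D} {σ} {vtx' i} {vtx i} D≥0 valid (λ ())
                     (subst (λ k → deg D < + k) (sym (ifEq-refl i (bigM n m r))) deg<M)

    const-not-rankAtLeast-suc : ¬ RankAtLeast (suc r) (λ _ → + r)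
    const-not-rankAtLeast-suc rank with rank (+_ ∘ chipsOnT (suc r)) (λ _ → +≤+ z≤n) (deg-chipsOnT (suc r))
    ... | σ , valid-after-removal = -1≱0 (subst (0ℤ ≤_) at-T (valid-after-removal T))
      where
      valid : Effective ((λ _ → + r) -ᴰ Lap σ)
      valid = Effective-unsubtract {λ _ → + r} {+_ ∘ chipsOnT (suc r)} {σ} (λ _ → +≤+ z≤n) valid-after-removal
      at-T : (+ r - + suc r) - Lap σ T ≡ -1ℤ
      at-T = trans (cong (_-_ (+ r - + suc r)) (Lap-T σ (σ-tv≡σ-T {λ _ → + r} (λ _ → +≤+ z≤n) deg-const<M σ valid))) (minus-succ (+ r))
        where
        minus-succ : ∀ x → (x - (1ℤ + x)) - 0ℤ ≡ -1ℤ
        minus-succ = solve-∀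
      -1≱0 : ¬ 0ℤ ≤ -1ℤ
      -1≱0 ()

    dgon<M : ∀ {D} → DegIsDgon r D → deg D < + bigM n m r
    dgon<M (_ , minimal) = ≤-<-trans (minimal (λ _ → + r) (rankAtLeast-const ∈-allVx r , const-not-rankAtLeast-suc)) deg-const<M

    r+1≤-of-gap : ∀ {x y z} → x < y → + c * (y - x) ≤ z → + suc r ≤ z
    r+1≤-of-gap x<y c[y-x]≤z =
      ≤-trans (+≤+ (subst (suc r ℕ.≤_) (ℕ.+-comm 2 r) (ℕ.n≤1+n (suc r)))) (≤-trans (+k≤+k*[b-a] c x<y) c[y-x]≤z)

    module _ {D : Divisor} (D≥0 : Effective D) (dgon : DegIsDgon r D) (v : Fin n) where

      deg<M : deg D < + bigM n m r
      deg<M = dgon<M {D} dgon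

      valid-bounds : ∀ σ → Effective (D -ᴰ Lap σ) →
                     (+ c * (σ T - σ (vtx v)) ≤ D (tv v)) × (+ c * (σ (vtx v) - σ T) ≤ D (vtx' v))
      valid-bounds σ valid =
        Lap-bounds σ v (σ-tv≡σ-T D≥0 deg<M σ valid v) (σ-v′≡σ-v D≥0 deg<M σ valid v) D valid

      rank-witness : ∀ k k′ → k ℕ.+ k′ ≡ r →
                     ∃[ σ ] Effective (D -ᴰ Lap σ) × (+ c * (σ T - σ (vtx v)) ≤ D (tv v) - + k)
                                                  × (+ c * (σ (vtx v) - σ T) ≤ D (vtx' v) - + k′)
      rank-witness k k′ k+k′≡r with proj₁ (proj₁ dgon) (+_ ∘ chipsOnTv+v′ v k k′) (λ _ → +≤+ z≤n)
                                      (trans (deg-chipsOnTv+v′ v k k′) (cong +_ k+k′≡r))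
      ... | σ , valid-after-removal =
        σ , valid ,
        subst (λ j → + c * (σ T - σ (vtx v)) ≤ D (tv v) - + j) (ifEq-refl v k) (proj₁ bounds) ,
        subst (λ j → + c * (σ (vtx v) - σ T) ≤ D (vtx' v) - + j) (ifEq-refl v k′) (proj₂ bounds)
        where
        valid : Effective (D -ᴰ Lap σ)
        valid = Effective-unsubtract {D} {+_ ∘ chipsOnTv+v′ v k k′} {σ} (λ _ → +≤+ z≤n) valid-after-removal
        bounds : (+ c * (σ T - σ (vtx v)) ≤ D (tv v) - + ifEq v v k)
               × (+ c * (σ (vtx v) - σ T) ≤ D (vtx' v) - + ifEq v v k′)
        bounds = Lap-bounds σ v (σ-tv≡σ-T D≥0 deg<M σ valid v) (σ-v′≡σ-v D≥0 deg<M σ valid v)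
                   (D -ᴰ (+_ ∘ chipsOnTv+v′ v k k′)) valid-after-removal

      splittable : Splittable r (D (tv v)) (D (vtx' v))
      splittable k k′ k+k′≡r =
        let σ , _ , at-tv , at-v′ = rank-witness k k′ k+k′≡r in
        σ T - σ (vtx v) , at-tv , subst (λ d → + c * d ≤ D (vtx' v) - + k′) (sym (-[i-j]≡j-i (σ T) (σ (vtx v)))) at-v′

      2r≤a+b-if-sim : SimD D T (vtx v) → + (2 ℕ.* r) ≤ D (tv v) + D (vtx' v)
      2r≤a+b-if-sim sim = subst (_≤ D (tv v) + D (vtx' v)) (cong (λ x → + (r ℕ.+ x)) (sym (ℕ.+-identityʳ r))) (+-mono-≤ r≤a r≤b)
        where
        r≤a : + r ≤ D (tv v)
        r≤a = let σ , valid , at-tv , _ = rank-witness r 0 (ℕ.+-identityʳ r) in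
              0≤i-j⇒j≤i (subst (_≤ D (tv v) - + r) (+k*[a-b]≡0 c (sim σ valid)) at-tv)
        r≤b : + r ≤ D (vtx' v)
        r≤b = let σ , valid , _ , at-v′ = rank-witness 0 r refl in
              0≤i-j⇒j≤i (subst (_≤ D (vtx' v) - + r) (+k*[a-b]≡0 c (sym (sim σ valid))) at-v′)

      sim-if-a+b≤2r : D (tv v) + D (vtx' v) ≤ + (2 ℕ.* r) → SimD D T (vtx v)
      sim-if-a+b≤2r a+b≤2r σ valid with <-cmp (σ T) (σ (vtx v))
      ... | tri≈ _ σT≡σv _ = σT≡σv
      ... | tri< σT<σv _ _ =
        ⊥-elim (<⇒≱ (Splittable⇒2r<a+b (Splittable-sym {r} {D (tv v)} {D (vtx' v)} splittable) (r+1≤-of-gap σT<σv (proj₂ (valid-bounds σ valid))) (D≥0 (tv v)))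
                    (≤-trans (≤-reflexive (+-comm (D (vtx' v)) (D (tv v)))) a+b≤2r))
      ... | tri> _ _ σv<σT =
        ⊥-elim (<⇒≱ (Splittable⇒2r<a+b splittable (r+1≤-of-gap σv<σT (proj₁ (valid-bounds σ valid))) (D≥0 (vtx' v))) a+b≤2r)

open import Defs
open import Data.Nat using (ℕ; suc; _*_)
open import Data.Integer using (+_; _+_; _≤_)
open import Data.Fin using (Fin)
open import Data.Vec using (Vec)
open import Data.Product using (_×_; _,_)
open import Function using (_∘_)
open import Relation.Nullary using (¬_)
open import Data.Integer.Properties using (i<j⇒suc[i]≤j; ≰⇒>)

lemma3p5 : (n m : ℕ) (es : Vec (Fin n × Fin n) m) → Loopless n m es → Connected n m es →
    (r : ℕ) → 1 Data.Nat.≤ r →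
    let open DivisorTheory (G'r n m es r) in
    (D : Divisor) → Effective D → DegIsDgon r D →
    (v : Fin n) →
      (SimD D T (vtx v) → + (2 * r) ≤ D (tv v) + D (vtx' v))
      × (¬ SimD D T (vtx v) → + (suc (2 * r)) ≤ D (tv v) + D (vtx' v))
lemma3p5 n m es _ _ r _ D D≥0 dgon v =
  2r≤a+b-if-sim D≥0 dgon v ,
  λ not-sim → i<j⇒suc[i]≤j (≰⇒> (not-sim ∘ sim-if-a+b≤2r D≥0 dgon v))
  where
  open G'ᵣ n m es r
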